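{- Let $G$ and $H$ be !-tensors with compatible boundaries, let $A$ be a !-box name and $K$ a !-tensor such that $\mathrm{Wk}_A^K(G)$ and $\mathrm{Wk}_A^K(H)$ are well-formed. Then $\mathrm{Wk}_A^K(G)$ and $\mathrm{Wk}_A^K(H)$ have compatible boundaries.
   Context: Fix disjoint infinite sets $\mathcal E$ (edge names) and $\mathcal B$ (!-box names) and a signature $\Sigma$. Each $a\in\mathcal E$ gives an output $\hat a$ and an input $\check a$. Edgeterms: $\epsilon$; $\hat a,\check a$; clockwise groups $[e\rangle_A$ and anticlockwise groups $\langle e]_A$; concatenations $ef$ (modulo associativity, unit $\epsilon$, $[\epsilon\rangle_A\equiv\epsilon\equiv\langle\epsilon]_A$). !-pretensor expressions: $1$; identity tensors $1_{\hat a\check b}$; nodes $\phi_e$; !-boxes $[G]_A$; products $GH$. For a directed edge $x$ in node $\phi_e$ of $G$: $\mathrm{ectx}_G(x)=[E_1,\dots,E_n]$ lists edge groups of $e$ containing $x$ (innermost first), $\mathrm{nctx}_G(x)=[N_1,\dots,N_m]$ lists the !-boxes containing the node (innermost first), $\mathrm{ctx}_G(x)=[E_1,\dots,E_n,N_1,\dots,N_m]$ (for identity tensors: empty edge context, node context the enclosing !-boxes). $A\prec_G B$ means $A$ is nested immediately in $B$; $a$ is bound if both $\hat a,\check a$ occur, free otherwise. A !-tensor expression satisfies: (F1) each $\hat a,\check a$ occurs at most once; (F2) each !-box name labels at most one !-box; (C1) $\mathrm{ectx}_G(x)\cap\mathrm{nctx}_G(x)=\emptyset$; (C2) if $\mathrm{ectx}_G(x)=[B_1,\dots,B_n]$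 then the $B_i$ are !-boxes of $G$ with $B_1\prec_G\cdots\prec_G B_n$; (C3) for each bound $a$ there exist lists $es,bs$ with $es.\mathrm{nctx}_G(\check a)=\mathrm{ectx}_G(\hat a).bs$ and $es.\mathrm{nctx}_G(\hat a)=\mathrm{ectx}_G(\check a).bs$. A !-tensor is an equivalence class of !-tensor expressions (under renaming of bound names, associativity/commutativity/unit of products, edgeterm equivalences, and contraction of identity tensors). Two !-tensors $G,H$ have compatible boundaries if they have identical free edge names and identical sets of !-boxes, $A\prec_G B\Leftrightarrow A\prec_H B$ for all !-boxes, and $\mathrm{ctx}_G(x)=\mathrm{ctx}_H(x)$ for all free directed edges $x$. Weakening: $\mathrm{Wk}_A^K([G]_A)=[GK]_A$, $\mathrm{Wk}_A^K([G]_B)=[\mathrm{Wk}_A^K(G)]_B$ for $B\ne A$, $\mathrm{Wk}_A^K(GH)=\mathrm{Wk}_A^K(G)\mathrm{Wk}_A^K(H)$, $\mathrm{Wk}_A^K(x)=x$ for $x\in\{1,1_{\hat a\check b},\phi_e\}$. -}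

module Defs where

open import Data.Nat using (ℕ)
open import Data.List using (List; []; _∷_; _++_; map)
open import Data.List.Membership.Propositional using (_∈_; _∉_)
open import Data.List.Relation.Unary.All using (All)
open import Data.List.Relation.Unary.Unique.Propositional using (Unique)
open import Data.List.Relation.Unary.Linked using (Linked)
open import Data.Product using (Σ; ∃; ∃-syntax; _×_; _,_; proj₁)
open import Relation.Binary.PropositionalEquality using (_≡_)
open import Relation.Nullary using (¬_)
open import Function.Bundles using (_⇔_)

-- Edge names and !-box names are both represented by ℕ, but they live in
-- different syntactic positions, so the two name sets are disjoint by construction.
EName : Set
EName = ℕ

BName : Set
BName = ℕ

data Edge : Set where
  ε    : Edge
  out  : EName → Edge               -- â
  inp  : EName → Edge               -- ǎ
  cw   : Edge → BName → Edge        -- [e⟩_A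
  acw  : Edge → BName → Edge        -- ⟨e]_A
  _·_  : Edge → Edge → Edge

data PT (S : Set) : Set where
  one   : PT S
  ident : EName → EName → PT S       -- 1_{â b̌}
  node  : S → Edge → PT S
  box   : PT S → BName → PT S
  _⊗_   : PT S → PT S → PT S

data DEdge : Set where
  hat   : EName → DEdge
  check : EName → DEdge

partner : DEdge → DEdge
partner (hat a)   = check a
partner (check a) = hat a

-- Occurrences of directed edges in an edgeterm, with the list of enclosing
-- edge groups (innermost first); the second argument is the current stack.
occsE : Edge → List BName → List (DEdge × List BName)
occsE ε         s = []
occsE (out a)   s = (hat a , s) ∷ []
occsE (inp a)   s = (check a , s) ∷ []
occsE (cw e A)  s = occsE e (A ∷ s)
occsE (acw e A) s = occsE e (A ∷ s)
occsE (e · f)   s = occsE e s ++ occsE f s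

-- An occurrence record: (x , ectx , nctx)
Occ : Set
Occ = DEdge × List BName × List BName

attach : List BName → DEdge × List BName → Occ
attach ns (x , es) = (x , es , ns)

occsP : ∀ {S} → PT S → List BName → List Occ
occsP one           s = []
occsP (ident a b)   s = (hat a , [] , s) ∷ (check b , [] , s) ∷ []
occsP (node φ e)    s = map (attach s) (occsE e [])
occsP (box G A)     s = occsP G (A ∷ s)
occsP (G ⊗ H)       s = occsP G s ++ occsP H s

occs : ∀ {S} → PT S → List Occ
occs G = occsP G []

-- !-boxes of a pretensor, each with the stack of !-boxes enclosing it (innermost first)
boxesP : ∀ {S} → PT S → List BName → List (BName × List BName)
boxesP one         s = []
boxesP (ident a b) s = []
boxesP (node φ e)  s = []
boxesP (box G A)   s = (A , s) ∷ boxesP G (A ∷ s)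
boxesP (G ⊗ H)     s = boxesP G s ++ boxesP H s

boxNames : ∀ {S} → PT S → List BName
boxNames G = map proj₁ (boxesP G [])

_≺[_]_ : ∀ {S} → BName → PT S → BName → Set
A ≺[ G ] B = ∃[ s ] ((A , B ∷ s) ∈ boxesP G [])

OccursWith : ∀ {S} → PT S → DEdge → List BName → List BName → Set
OccursWith G x es ns = (x , es , ns) ∈ occs G

Occurs : ∀ {S} → PT S → DEdge → Set
Occurs G x = ∃[ es ] ∃[ ns ] OccursWith G x es ns

Bound : ∀ {S} → PT S → EName → Set
Bound G a = Occurs G (hat a) × Occurs G (check a)

FreeDir : ∀ {S} → PT S → DEdge → Set
FreeDir G x = Occurs G x × ¬ Occurs G (partner x)

CtxOf : ∀ {S} → PT S → DEdge → List BName → Set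
CtxOf G x c = ∃[ es ] ∃[ ns ] (OccursWith G x es ns × c ≡ es ++ ns)

dedges : ∀ {S} → PT S → List DEdge
dedges G = map proj₁ (occs G)

Disjoint : List BName → List BName → Set
Disjoint xs ys = ∀ {B} → B ∈ xs → B ∉ ys

record WF {S : Set} (G : PT S) : Set where
  field
    F1 : Unique (dedges G)
    F2 : Unique (boxNames G)
    C1 : ∀ x es ns → OccursWith G x es ns → Disjoint es ns
    C2 : ∀ x es ns → OccursWith G x es ns →
           All (λ B → B ∈ boxNames G) es × Linked (λ A B → A ≺[ G ] B) es
    C3 : ∀ a eh nh ec nc → OccursWith G (hat a) eh nh → OccursWith G (check a) ec nc →
           ∃[ es ] ∃[ bs ] ((es ++ nc ≡ eh ++ bs) × (es ++ nh ≡ ec ++ bs))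

record Compat {S : Set} (G H : PT S) : Set where
  field
    freeEdges : ∀ x → FreeDir G x ⇔ FreeDir H x
    sameBoxes : ∀ B → (B ∈ boxNames G) ⇔ (B ∈ boxNames H)
    sameNest  : ∀ A B → (A ≺[ G ] B) ⇔ (A ≺[ H ] B)
    sameCtx   : ∀ x c → FreeDir G x → FreeDir H x → (CtxOf G x c ⇔ CtxOf H x c)

Wk : ∀ {S} → BName → PT S → PT S → PT S
Wk A K one         = one
Wk A K (ident a b) = ident a b
Wk A K (node φ e)  = node φ e
Wk A K (box G B) with A Data.Nat.≟ B
... | Relation.Nullary.yes _ = box (G ⊗ K) B
... | Relation.Nullary.no _  = box (Wk A K G) B
Wk A K (G ⊗ H)     = Wk A K G ⊗ Wk A K H

module Submission where

-- Wk_A^K(G) differs from G only by a copy of K placed directly inside every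
-- outermost !-box named A.  Writing  sites A G  for the list of !-box stacks
-- at which these copies are placed, we first show, for every "compositional"
-- list of data collected from a !-pretensor (its directed-edge occurrences and
-- its !-boxes), that the data of Wk_A^K(G) is a permutation of the data of G
-- followed by the data of K collected under each stack  A ∷ t,  t ∈ sites A G.
-- Next, if G and H have compatible boundaries and unique !-box names, every
-- !-box has the same stack in G and in H; in particular G and H have the same
-- weakening sites.  Each component of Compat (Wk G) (Wk H) then follows by
-- splitting an occurrence or !-box of Wk G into "from G" (transported by
-- Compat G H) or "from an inserted copy of K" (shared, as the sites agree);
-- only freeness needs F1 of the weakened tensors, to rule out an edge of K
-- that also occurs in H.

open import Defs
open import Data.Nat using (_≟_)
open import Data.List using (List; []; _∷_; _++_; map; concatMap)
open import Data.List.Properties using (++-assoc; ++-identityʳ; concatMap-++; map-++)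
open import Data.List.Membership.Propositional using (_∈_; find; lose)
open import Data.List.Membership.Propositional.Properties
  using (∈-map⁺; ∈-map⁻; ∈-++⁺ˡ; ∈-++⁺ʳ; ∈-++⁻; ∈-concatMap⁺; ∈-concatMap⁻)
open import Data.List.Relation.Unary.Any using (here; there)
import Data.List.Relation.Unary.All as All
open import Data.List.Relation.Unary.AllPairs using (_∷_)
open import Data.List.Relation.Unary.Unique.Propositional using (Unique)
open import Data.List.Relation.Binary.Permutation.Propositional
  using (_↭_; ↭-sym; ↭-reflexive; ↭⇒↭ₛ; module PermutationReasoning)
import Data.List.Relation.Binary.Permutation.Propositional.Properties as ↭
import Data.List.Relation.Binary.Permutation.Setoid.Properties as ↭ₛ
open import Data.Product using (∃-syntax; _×_; _,_; proj₁; proj₂)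
open import Data.Empty using (⊥-elim)
open import Data.Sum using (_⊎_; inj₁; inj₂)
open import Relation.Binary.PropositionalEquality
  using (_≡_; _≢_; refl; cong; cong₂; subst; setoid)
open import Relation.Nullary using (¬_; yes; no)
open import Function.Bundles using (mk⇔; Equivalence)
import Function.Properties.Equivalence as ⇔

unique-++-apart : {X : Set} (xs : List X) {ys : List X} {x y : X} →
  Unique (xs ++ ys) → x ∈ xs → y ∈ ys → x ≢ y
unique-++-apart (_ ∷ xs) (x≢ ∷ _) (here refl) y∈ys = All.lookup x≢ (∈-++⁺ʳ xs y∈ys)
unique-++-apart (_ ∷ xs) (_ ∷ u) (there x∈xs) y∈ys = unique-++-apart xs u x∈xs y∈ys

unique-keys : {X Y : Set} (xs : List (X × Y)) {a : X} {b c : Y} →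
  Unique (map proj₁ xs) → (a , b) ∈ xs → (a , c) ∈ xs → b ≡ c
unique-keys (_ ∷ xs) u (here refl) (here refl) = refl
unique-keys (_ ∷ xs) (a∉ ∷ _) (here refl) (there m) = ⊥-elim (All.lookup a∉ (∈-map⁺ proj₁ m) refl)
unique-keys (_ ∷ xs) (a∉ ∷ _) (there m) (here refl) = ⊥-elim (All.lookup a∉ (∈-map⁺ proj₁ m) refl)
unique-keys (_ ∷ xs) (_ ∷ u) (there m) (there m′) = unique-keys xs u m m′

interchange : {X : Set} (as bs cs ds : List X) →
  (as ++ bs) ++ (cs ++ ds) ↭ (as ++ cs) ++ (bs ++ ds)
interchange as bs cs ds = begin
  (as ++ bs) ++ (cs ++ ds)  ≡⟨ ++-assoc as bs (cs ++ ds) ⟩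
  as ++ (bs ++ (cs ++ ds))  ↭⟨ ↭.++⁺ˡ as (↭.shifts bs cs) ⟩
  as ++ (cs ++ (bs ++ ds))  ≡⟨ ++-assoc as cs (bs ++ ds) ⟨
  (as ++ cs) ++ (bs ++ ds)  ∎
  where open PermutationReasoning

unique-resp-↭ : {X : Set} {xs ys : List X} → xs ↭ ys → Unique xs → Unique ys
unique-resp-↭ {X} p = ↭ₛ.Unique-resp-↭ (setoid X) (↭⇒↭ₛ p)

-- The weakening sites of A in G: the stacks of enclosing !-boxes of the
-- outermost !-boxes named A, i.e. the places where Wk_A^K inserts K.
sites : {S : Set} → BName → PT S → List BName → List (List BName)
sites A one         s = []
sites A (ident a b) s = []
sites A (node φ e)  s = []
sites A (box G B)   s with A ≟ B
... | yes _ = s ∷ []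
... | no _  = sites A G (B ∷ s)
sites A (G ⊗ H)     s = sites A G s ++ sites A H s

site⇒box : {S : Set} (A : BName) (G : PT S) (s : List BName) {t : List BName} →
  t ∈ sites A G s → (A , t) ∈ boxesP G s
site⇒box A (box G B) s t∈ with A ≟ B
site⇒box A (box G B) s (here refl) | yes refl = here refl
...                                | no _     = there (site⇒box A G (B ∷ s) t∈)
site⇒box A (G ⊗ H) s t∈ with ∈-++⁻ (sites A G s) t∈
... | inj₁ t∈G = ∈-++⁺ˡ (site⇒box A G s t∈G)
... | inj₂ t∈H = ∈-++⁺ʳ (boxesP G s) (site⇒box A H s t∈H)

box⇒site : {S : Set} (A : BName) (G : PT S) (s : List BName) {t : List BName} →
  (A , t) ∈ boxesP G s → ∃[ u ] (u ∈ sites A G s)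
box⇒site A (box G B) s m with A ≟ B
... | yes _ = s , here refl
box⇒site A (box G B) s (here refl) | no A≢A = ⊥-elim (A≢A refl)
box⇒site A (box G B) s (there m)   | no _   = box⇒site A G (B ∷ s) m
box⇒site A (G ⊗ H) s m with ∈-++⁻ (boxesP G s) m
... | inj₁ m′ = let u , u∈ = box⇒site A G s m′ in u , ∈-++⁺ˡ u∈
... | inj₂ m′ = let u , u∈ = box⇒site A H s m′ in u , ∈-++⁺ʳ (sites A G s) u∈

record Compositional {S X : Set} (c : PT S → List BName → List X) : Set where
  field
    atBox  : BName → List BName → List X
    box-eq : ∀ G B s → c (box G B) s ≡ atBox B s ++ c G (B ∷ s)
    ⊗-eq   : ∀ G H s → c (G ⊗ H) s ≡ c G s ++ c H s

occsP-compositional : {S : Set} → Compositional {S} occsP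
occsP-compositional = record
  { atBox = λ _ _ → [] ; box-eq = λ _ _ _ → refl ; ⊗-eq = λ _ _ _ → refl }

boxesP-compositional : {S : Set} → Compositional {S} boxesP
boxesP-compositional = record
  { atBox = λ B s → (B , s) ∷ [] ; box-eq = λ _ _ _ → refl ; ⊗-eq = λ _ _ _ → refl }

module Weakening {S X : Set} (A : BName) (K : PT S)
                 {c : PT S → List BName → List X} (comp : Compositional c) where
  open Compositional comp

  inserted : PT S → List BName → List X
  inserted G s = concatMap (λ t → c K (A ∷ t)) (sites A G s)

  split : ∀ G s → c (Wk A K G) s ↭ c G s ++ inserted G s
  split one         s = ↭-sym (↭-reflexive (++-identityʳ (c one s)))
  split (ident a b) s = ↭-sym (↭-reflexive (++-identityʳ (c (ident a b) s)))
  split (node φ e)  s = ↭-sym (↭-reflexive (++-identityʳ (c (node φ e) s)))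
  split (box G B)   s with A ≟ B
  ... | yes refl = begin
    c (box (G ⊗ K) A) s                        ≡⟨ box-eq (G ⊗ K) A s ⟩
    atBox A s ++ c (G ⊗ K) (A ∷ s)             ≡⟨ cong (atBox A s ++_) (⊗-eq G K (A ∷ s)) ⟩
    atBox A s ++ (c G (A ∷ s) ++ c K (A ∷ s))  ≡⟨ ++-assoc (atBox A s) _ _ ⟨
    (atBox A s ++ c G (A ∷ s)) ++ c K (A ∷ s)  ≡⟨ cong₂ _++_ (box-eq G A s) (++-identityʳ (c K (A ∷ s))) ⟨
    c (box G A) s ++ (c K (A ∷ s) ++ [])       ∎
    where open PermutationReasoning
  ... | no _ = begin
    c (box (Wk A K G) B) s                         ≡⟨ box-eq (Wk A K G) B s ⟩
    atBox B s ++ c (Wk A K G) (B ∷ s)              ↭⟨ ↭.++⁺ˡ (atBox B s) (split G (B ∷ s)) ⟩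
    atBox B s ++ (c G (B ∷ s) ++ inserted G (B ∷ s)) ≡⟨ ++-assoc (atBox B s) _ _ ⟨
    (atBox B s ++ c G (B ∷ s)) ++ inserted G (B ∷ s) ≡⟨ cong (_++ inserted G (B ∷ s)) (box-eq G B s) ⟨
    c (box G B) s ++ inserted G (B ∷ s)            ∎
    where open PermutationReasoning
  split (G ⊗ H) s = begin
    c (Wk A K G ⊗ Wk A K H) s                            ≡⟨ ⊗-eq (Wk A K G) (Wk A K H) s ⟩
    c (Wk A K G) s ++ c (Wk A K H) s                     ↭⟨ ↭.++⁺ (split G s) (split H s) ⟩
    (c G s ++ inserted G s) ++ (c H s ++ inserted H s)   ↭⟨ interchange (c G s) _ _ _ ⟩
    (c G s ++ c H s) ++ (inserted G s ++ inserted H s)   ≡⟨ cong₂ _++_ (⊗-eq G H s) (concatMap-++ _ (sites A G s) _) ⟨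
    c (G ⊗ H) s ++ inserted (G ⊗ H) s                    ∎
    where open PermutationReasoning

  ∈-wk⁻ : ∀ G s {o} → o ∈ c (Wk A K G) s →
    o ∈ c G s ⊎ ∃[ t ] (t ∈ sites A G s × o ∈ c K (A ∷ t))
  ∈-wk⁻ G s o∈ with ∈-++⁻ (c G s) (↭.∈-resp-↭ (split G s) o∈)
  ... | inj₁ o∈G = inj₁ o∈G
  ... | inj₂ o∈K = inj₂ (find (∈-concatMap⁻ (λ t → c K (A ∷ t)) o∈K))

  ∈-wk⁺ˡ : ∀ G s {o} → o ∈ c G s → o ∈ c (Wk A K G) s
  ∈-wk⁺ˡ G s o∈ = ↭.∈-resp-↭ (↭-sym (split G s)) (∈-++⁺ˡ o∈)

  ∈-wk⁺ʳ : ∀ G s {o t} → t ∈ sites A G s → o ∈ c K (A ∷ t) → o ∈ c (Wk A K G) s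
  ∈-wk⁺ʳ G s t∈ o∈ = ↭.∈-resp-↭ (↭-sym (split G s))
    (∈-++⁺ʳ (c G s) (∈-concatMap⁺ (λ t → c K (A ∷ t)) (lose t∈ o∈)))

  wk-apart : ∀ {Y : Set} (f : X → Y) G s {o o′ t} → Unique (map f (c (Wk A K G) s)) →
    o ∈ c G s → t ∈ sites A G s → o′ ∈ c K (A ∷ t) → f o ≢ f o′
  wk-apart f G s u o∈ t∈ o′∈ = unique-++-apart (map f (c G s)) unique-split
    (∈-map⁺ f o∈) (∈-map⁺ f (∈-concatMap⁺ (λ t → c K (A ∷ t)) (lose t∈ o′∈)))
    where
    unique-split : Unique (map f (c G s) ++ map f (inserted G s))
    unique-split = subst Unique (map-++ f (c G s) (inserted G s))
      (unique-resp-↭ (↭.map⁺ f (split G s)) u)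

enclosing : {S : Set} (G : PT S) (s : List BName) {B C : BName} {r : List BName} →
  (B , C ∷ r) ∈ boxesP G s → (C , r) ∈ boxesP G s ⊎ C ∷ r ≡ s
enclosing (box G A) s (here refl) = inj₂ refl
enclosing (box G A) s (there m) with enclosing G (A ∷ s) m
... | inj₁ m′   = inj₁ (there m′)
... | inj₂ refl = inj₁ (here refl)
enclosing (G ⊗ H) s m with ∈-++⁻ (boxesP G s) m
... | inj₁ m′ with enclosing G s m′
...   | inj₁ m″ = inj₁ (∈-++⁺ˡ m″)
...   | inj₂ eq = inj₂ eq
enclosing (G ⊗ H) s m | inj₂ m′ with enclosing H s m′
...   | inj₁ m″ = inj₁ (∈-++⁺ʳ (boxesP G s) m″)
...   | inj₂ eq = inj₂ eq

parent : {S : Set} (G : PT S) {B C : BName} {r : List BName} →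
  (B , C ∷ r) ∈ boxesP G [] → (C , r) ∈ boxesP G []
parent G m with enclosing G [] m
... | inj₁ m′ = m′
... | inj₂ ()

named : {S : Set} (G : PT S) {B : BName} {s : List BName} →
  (B , s) ∈ boxesP G [] → B ∈ boxNames G
named G = ∈-map⁺ proj₁

stackOf : {S : Set} (G : PT S) {B : BName} → B ∈ boxNames G → ∃[ s ] ((B , s) ∈ boxesP G [])
stackOf G B∈ with ∈-map⁻ proj₁ B∈
... | (_ , s) , m , refl = s , m

module Compatible {S : Set} {G H : PT S} (wG : WF G) (wH : WF H) (c : Compat G H) where
  open Compat c
  open Equivalence

  sameStack : ∀ t {B} → (B , t) ∈ boxesP G [] → (B , t) ∈ boxesP H []
  sameStack [] {B} m with stackOf H (to (sameBoxes B) (named G m))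
  ... | [] , m′ = m′
  ... | C ∷ r , m′ with from (sameNest B C) (r , m′)
  ...   | _ , m″ with () ← unique-keys (boxesP G []) (WF.F2 wG) m m″
  sameStack (C ∷ r) {B} m with to (sameNest B C) (r , m)
  ... | r′ , m′ with unique-keys (boxesP H []) (WF.F2 wH) (sameStack r (parent G m)) (parent H m′)
  ...   | refl = m′

  sitesAgree : ∀ A {t} → t ∈ sites A G [] → t ∈ sites A H []
  sitesAgree A t∈ with box⇒site A H [] (sameStack _ (site⇒box A G [] t∈))
  ... | u , u∈ with unique-keys (boxesP H []) (WF.F2 wH)
                      (site⇒box A H [] u∈) (sameStack _ (site⇒box A G [] t∈))
  ...   | refl = u∈

partner² : ∀ y → partner (partner y) ≡ y
partner² (hat _)   = refl
partner² (check _) = refl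

symCompat : {S : Set} {G H : PT S} → Compat G H → Compat H G
symCompat c = record
  { freeEdges = λ x → ⇔.sym (Compat.freeEdges c x)
  ; sameBoxes = λ B → ⇔.sym (Compat.sameBoxes c B)
  ; sameNest  = λ B C → ⇔.sym (Compat.sameNest c B C)
  ; sameCtx   = λ x ct freeH freeG → ⇔.sym (Compat.sameCtx c x ct freeG freeH) }

module Transfer {S : Set} (A : BName) (K : PT S) {G H : PT S}
                (wG : WF G) (wH : WF H) (c : Compat G H) (wWH : WF (Wk A K H)) where
  open Compat c
  open Equivalence
  open Compatible wG wH c using (sameStack; sitesAgree)
  open Compatible wH wG (symCompat c) using () renaming (sitesAgree to sitesAgree⁻)
  module Occ = Weakening A K occsP-compositional
  module Box = Weakening A K boxesP-compositional

  boxTo : ∀ {o} → o ∈ boxesP (Wk A K G) [] → o ∈ boxesP (Wk A K H) []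
  boxTo m with Box.∈-wk⁻ G [] m
  ... | inj₁ m′              = Box.∈-wk⁺ˡ H [] (sameStack _ m′)
  ... | inj₂ (t , t∈ , m′) = Box.∈-wk⁺ʳ H [] (sitesAgree A t∈) m′

  boxesTo : ∀ B → B ∈ boxNames (Wk A K G) → B ∈ boxNames (Wk A K H)
  boxesTo B B∈ = named (Wk A K H) (boxTo (proj₂ (stackOf (Wk A K G) B∈)))

  nestTo : ∀ B C → B ≺[ Wk A K G ] C → B ≺[ Wk A K H ] C
  nestTo B C (r , m) = r , boxTo m

  fromH : ∀ {x es ns} → ¬ Occurs (Wk A K G) x →
    (x , es , ns) ∈ occs (Wk A K H) → (x , es , ns) ∈ occs H
  fromH x∉ m with Occ.∈-wk⁻ H [] m
  ... | inj₁ m′              = m′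
  ... | inj₂ (t , t∈ , m′) = ⊥-elim (x∉ (_ , _ , Occ.∈-wk⁺ʳ G [] (sitesAgree⁻ A t∈) m′))

  freeInG : ∀ {x es ns} → FreeDir (Wk A K G) x → (x , es , ns) ∈ occs G → FreeDir G x
  freeInG (_ , y∉) m = (_ , _ , m) , λ (_ , _ , m′) → y∉ (_ , _ , Occ.∈-wk⁺ˡ G [] m′)

  freeTo : ∀ x → FreeDir (Wk A K G) x → FreeDir (Wk A K H) x
  freeTo x f@((_ , _ , m) , y∉) with Occ.∈-wk⁻ G [] m
  ... | inj₁ m′ with to (freeEdges x) (freeInG f m′)
  ...   | (_ , _ , mH) , y∉H =
          (_ , _ , Occ.∈-wk⁺ˡ H [] mH) , λ (_ , _ , m″) → y∉H (_ , _ , fromH y∉ m″)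
  freeTo x ((_ , _ , m) , y∉) | inj₂ (t , t∈ , mK) =
    (_ , _ , Occ.∈-wk⁺ʳ H [] t∈H mK) , λ (_ , _ , m″) → y∉ (occursInWkG (fromH y∉ m″))
    where
    t∈H : t ∈ sites A H []
    t∈H = sitesAgree A t∈
    -- x is not in H, since by F1 of Wk H it already occurs in the copy of K.
    x∉H : ¬ Occurs H (partner (partner x))
    x∉H o with subst (Occurs H) (partner² x) o
    ... | _ , _ , mH = Occ.wk-apart proj₁ H [] (WF.F1 wWH) mH t∈H mK refl
    -- so the partner of x, if it occurs in H, is free there, hence occurs in G.
    occursInWkG : ∀ {es ns} → (partner x , es , ns) ∈ occs H → Occurs (Wk A K G) (partner x)
    occursInWkG mH with from (freeEdges (partner x)) ((_ , _ , mH) , x∉H)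
    ... | (_ , _ , mG) , _ = _ , _ , Occ.∈-wk⁺ˡ G [] mG

  ctxTo : ∀ x ct → FreeDir (Wk A K G) x → FreeDir (Wk A K H) x →
    CtxOf (Wk A K G) x ct → CtxOf (Wk A K H) x ct
  ctxTo x ct f _ (es , ns , m , eq) with Occ.∈-wk⁻ G [] m
  ... | inj₂ (t , t∈ , mK) = es , ns , Occ.∈-wk⁺ʳ H [] (sitesAgree A t∈) mK , eq
  ... | inj₁ mG with freeInG f mG
  ...   | fG with to (sameCtx x ct fG (to (freeEdges x) fG)) (es , ns , mG , eq)
  ...     | es′ , ns′ , mH , eq′ = es′ , ns′ , Occ.∈-wk⁺ˡ H [] mH , eq′

mainTheorem6 : {S : Set} (G H K : PT S) (A : BName) →
    WF G → WF H → WF K → Compat G H →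
    WF (Wk A K G) → WF (Wk A K H) →
    Compat (Wk A K G) (Wk A K H)
mainTheorem6 G H K A wG wH _ c wWG wWH = record
  { freeEdges = λ x → mk⇔ (G→H.freeTo x) (H→G.freeTo x)
  ; sameBoxes = λ B → mk⇔ (G→H.boxesTo B) (H→G.boxesTo B)
  ; sameNest  = λ B C → mk⇔ (G→H.nestTo B C) (H→G.nestTo B C)
  ; sameCtx   = λ x ct fG fH → mk⇔ (G→H.ctxTo x ct fG fH) (H→G.ctxTo x ct fH fG) }
  where
  module G→H = Transfer A K wG wH c wWH
  module H→G = Transfer A K wH wG (symCompat c) wWG
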